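{- Let $p$ and $q$ be distinct rational primes with $p$ odd, let $P$ be a Hurwitz prime of norm $p$ and $Q$ a Hurwitz prime of norm $q$, and let $Q'$, $P'$ be Hurwitz primes of norms $q$ and $p$ respectively with $PQ = Q'P'$. For a Hurwitz prime $R$ of norm $p$ let $t_R$ denote a nonzero trace-zero element of the image of $\mathcal{H}R$ in $\overline{\mathcal{H}} = \mathcal{H}/p\mathcal{H}$ (unique up to scaling). Let $\overline{Q}$ denote the image of $Q$ in $\overline{\mathcal{H}}$. Then $\overline{Q}$ is invertible in $\overline{\mathcal{H}}$, and $t_{P'}$ and $\overline{Q}^{ -1} t_P \overline{Q}$ are equal up to scaling by an element of $\mathbb{F}_p^\times$.
   Context: $\mathcal{H}$ is the ring of Hurwitz integers: quaternions $a+bi+cj+dk$ with $a,b,c,d$ all in $\mathbb{Z}$ or all in $\mathbb{Z}+1/2$. Norm: $\mathrm{N}(a+bi+cj+dk)=a^2+b^2+c^2+d^2$; trace: $\operatorname{tr}(a+bi+cj+dk)=2a$. A Hurwitz prime is an irreducible element of $\mathcal{H}$. For odd $p$ and a Hurwitz prime $R$ of norm $p$, the image of $\mathcal{H}R$ in $\mathcal{H}/p\mathcal{H}$ is a two-dimensional $\mathbb{F}_p$-subspace containing a nonzero element of trace zero ($xi+yj+zk$), unique up to scaling. -}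

module Defs where

open import Data.Nat using (ℕ)
open import Data.Integer using (ℤ; +_; _+_; _-_; _*_; -_)
open import Data.Integer.DivMod using (_/_)
open import Data.Integer.Divisibility using (_∣_)
open import Data.Product using (Σ; _×_; ∃)
open import Data.Sum using (_⊎_)
open import Relation.Nullary using (¬_)
open import Relation.Binary.PropositionalEquality using (_≡_; _≢_)

-- A Hurwitz integer x = a+bi+cj+dk
-- (a,b,c,d all in ℤ or all in ℤ+1/2) is ENCODED by its double
-- 2x = (2a,2b,2c,2d) ∈ ℤ⁴; the Hurwitz condition becomes "all four
-- coordinates have the same parity".
record Quat : Set where
  constructor quat
  field
    re ii jj kk : ℤ
open Quat public

_·ℤ_ : Quat → Quat → Quat
quat a₁ b₁ c₁ d₁ ·ℤ quat a₂ b₂ c₂ d₂ = quat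
  (a₁ * a₂ - b₁ * b₂ - c₁ * c₂ - d₁ * d₂)
  (a₁ * b₂ + b₁ * a₂ + c₁ * d₂ - d₁ * c₂)
  (a₁ * c₂ - b₁ * d₂ + c₁ * a₂ + d₁ * b₂)
  (a₁ * d₂ + b₁ * c₂ - c₁ * b₂ + d₁ * a₂)

Even : ℤ → Set
Even z = + 2 ∣ z

Odd : ℤ → Set
Odd z = ¬ (+ 2 ∣ z)

Hurwitz : Quat → Set
Hurwitz (quat a b c d) = (Even a × Even b × Even c × Even d) ⊎ (Odd a × Odd b × Odd c × Odd d)

half : ℤ → ℤ
half z = z / (+ 2)

-- product of Hurwitz integers in the doubled encoding: 2(xy) = (2x)(2y)/2
-- (exact for Hurwitz inputs)
_⊗_ : Quat → Quat → Quat
X ⊗ Y with X ·ℤ Y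
... | quat a b c d = quat (half a) (half b) (half c) (half d)

_⊕_ : Quat → Quat → Quat
quat a₁ b₁ c₁ d₁ ⊕ quat a₂ b₂ c₂ d₂ = quat (a₁ + a₂) (b₁ + b₂) (c₁ + c₂) (d₁ + d₂)

_⋆_ : ℤ → Quat → Quat
n ⋆ quat a b c d = quat (n * a) (n * b) (n * c) (n * d)

zeroH oneH : Quat
zeroH = quat (+ 0) (+ 0) (+ 0) (+ 0)
oneH  = quat (+ 2) (+ 0) (+ 0) (+ 0)     -- doubled encoding of 1

-- N(x) = a²+b²+c²+d² ; in the doubled encoding N(x) = (sum of squares of 2x)/4
norm : Quat → ℤ
norm (quat a b c d) = (a * a + b * b + c * c + d * d) / (+ 4)

-- tr(x) = 2a = the first doubled coordinate
tr : Quat → ℤ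
tr X = re X

Unit : Quat → Set
Unit X = Σ Quat λ U → Hurwitz U × X ⊗ U ≡ oneH × U ⊗ X ≡ oneH

HurwitzPrime : Quat → Set
HurwitzPrime X =
  Hurwitz X × X ≢ zeroH × ¬ Unit X ×
  (∀ Y Z → Hurwitz Y → Hurwitz Z → X ≡ Y ⊗ Z → Unit Y ⊎ Unit Z)

CongMod : ℕ → Quat → Quat → Set
CongMod p X Y = Σ Quat λ Z → Hurwitz Z × X ≡ Y ⊕ ((+ p) ⋆ Z)

InImage : ℕ → Quat → Quat → Set
InImage p R T = Σ Quat λ H → Hurwitz H × CongMod p T (H ⊗ R)

IsTR : ℕ → Quat → Quat → Set
IsTR p R T = Hurwitz T × InImage p R T × (+ p ∣ tr T) × ¬ CongMod p T zeroH

InvMod : ℕ → Quat → Quat → Set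
InvMod p Q Qi = Hurwitz Qi × CongMod p (Q ⊗ Qi) oneH × CongMod p (Qi ⊗ Q) oneH

{-# OPTIONS --safe #-}

-- Work with doubled integer coordinates, modulo p.  An inverse of Q is u Q̄ with u N(Q) ≡ 1.
-- Put S = Q⁻¹ t Q.  As t ∈ ℋP and PQ = Q′P′, S lies in ℋQ′P′ ⊆ ℋP′; as t′ ∈ ℋP′ has trace 0,
-- its conjugate -t′ lies in P̄′ℋ.  Hence S t′ ∈ ℋ P′P̄′ ℋ = pℋ.  Both S and t′ are pure
-- (tr S = tr (Q Q⁻¹ t) = tr t), and for pure quaternions xy = -x·y + x × y, so the cross product
-- of S and t′ vanishes and t′ is a multiple of S ≢ 0; the multiple is a unit because t′ ≢ 0.
module Submission where

open import Defs
open import Data.Nat using (ℕ)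
open import Data.Nat.Primality using (Prime)
open import Data.Integer using (ℤ; +_)
open import Data.Integer.Divisibility using (_∣_)
open import Data.Product using (Σ; _×_)
open import Relation.Nullary using (¬_)
open import Relation.Binary.PropositionalEquality using (_≡_; _≢_)

open import Data.Nat as ℕ using (suc; zero; nonTrivial⇒≢1)
import Data.Nat.Properties as ℕ
import Data.Nat.Divisibility as ℕ
open import Data.Nat.Primality using (euclidsLemma; prime⇒irreducible; prime⇒nonTrivial; prime[2])
open import Data.Nat.Coprimality using (Coprime; coprime-Bézout)
open import Data.Nat.GCD using (module Bézout)
open import Data.Integer using (-[1+_]; _+_; _-_; _*_; -_; ∣_∣)
open import Data.Integer.Properties using (abs-*; pos-*; pos-+; i-j≡0⇒i≡j; *-comm; +-identityʳ; *-zeroʳ)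
open import Data.Integer.DivMod using (_/_; _%_; a≡a%n+[a/n]*n; n%d<d)
open import Data.Integer.Divisibility.Signed
  using (divides; ∣ᵤ⇒∣; ∣⇒∣ᵤ; ∣m∣n⇒∣m+n; ∣m∣n⇒∣m-n; ∣m+n∣n⇒∣m; ∣m+n∣m⇒∣n; ∣m⇒∣-m; ∣n⇒∣m*n; ∣m⇒∣m*n; ∣-refl)
  renaming (_∣_ to _∣ₛ_; _∣?_ to _∣ₛ?_)
open import Data.Integer.Tactic.RingSolver using (solve-∀)
open import Data.Integer.Solver using (module +-*-Solver)
open +-*-Solver using (Polynomial; prove; var; con; _:+_; _:*_; _:-_; :-_; ⟦_⟧; ⟦_⟧↓)
open import Data.Fin using (#_)
open import Data.Vec using (Vec; _∷_; [])
open import Data.Product using (_,_; proj₁; proj₂)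
open import Data.Sum as Sum using (_⊎_; inj₁; inj₂)
open import Data.Empty using (⊥-elim)
open import Function using (_∘_)
open import Relation.Nullary using (yes; no; contradiction)
open import Relation.Binary.Bundles using (Setoid)
import Relation.Binary.Reasoning.Setoid as SetoidReasoning
open import Level using (0ℓ)
open import Relation.Binary.PropositionalEquality
  using (refl; sym; trans; cong; cong₂; subst; module ≡-Reasoning)

private
  variable
    a b x y : ℤ
    p n : ℕ

x≡y+md⇒m∣x-y : ∀ {m} y d → x ≡ y + m * d → m ∣ₛ x - y
x≡y+md⇒m∣x-y {m = m} y d refl = divides d (lemma y m d)
  where
  lemma : ∀ y m d → (y + m * d) - y ≡ d * m
  lemma = solve-∀

x-y≡dm⇒x≡y+md : ∀ {m} d → x - y ≡ d * m → x ≡ y + m * d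
x-y≡dm⇒x≡y+md {x} {y} {m} d x-y≡dm = begin
  x               ≡⟨ lemma x y ⟩
  y + (x - y)     ≡⟨ cong (_+_ y) x-y≡dm ⟩
  y + d * m       ≡⟨ cong (_+_ y) (*-comm d m) ⟩
  y + m * d       ∎
  where
  open ≡-Reasoning
  lemma : ∀ x y → x ≡ y + (x - y)
  lemma = solve-∀

small-multiple≡0 : ∀ {r} z → z * + suc n ≡ + r → r ℕ.< suc n → z ≡ + 0
small-multiple≡0           (+ zero)  _    _   = refl
small-multiple≡0 {n = n}   (+ suc j) refl r<n = contradiction (ℕ.m≤m+n (suc n) (j ℕ.* suc n)) (ℕ.<⇒≱ r<n)
small-multiple≡0           -[1+ j ]  ()   _

[k*n]/n≡k : ∀ k n → (k * + suc n) / + suc n ≡ k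
[k*n]/n≡k k n = sym (i-j≡0⇒i≡j k q (small-multiple≡0 (k - q) [k-q]*n≡r (n%d<d kn (+ suc n))))
  where
  kn q : ℤ
  kn = k * + suc n
  q = kn / + suc n
  [k-q]*n≡r : (k - q) * + suc n ≡ + (kn % + suc n)
  [k-q]*n≡r = begin
    (k - q) * + suc n                          ≡⟨ lemma k q (+ suc n) ⟩
    kn - q * + suc n                           ≡⟨ cong (_- q * + suc n) (a≡a%n+[a/n]*n kn (+ suc n)) ⟩
    (+ (kn % + suc n) + q * + suc n) - q * + suc n ≡⟨ lemma′ (+ (kn % + suc n)) (q * + suc n) ⟩
    + (kn % + suc n)                           ∎
    where
    open ≡-Reasoning
    lemma : ∀ k q d → (k - q) * d ≡ k * d - q * d
    lemma = solve-∀
    lemma′ : ∀ r s → (r + s) - s ≡ r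
    lemma′ = solve-∀

odd⇒2∣pred : ¬ (+ 2 ∣ a) → + 2 ∣ₛ a - + 1
odd⇒2∣pred {a} 2∤a with a % + 2 | a≡a%n+[a/n]*n a (+ 2) | n%d<d a (+ 2)
... | 0           | a≡q*2   | _ = contradiction (∣⇒∣ᵤ (divides (a / + 2) (trans a≡q*2 (lemma (a / + 2))))) 2∤a
  where
  lemma : ∀ q → + 0 + q * + 2 ≡ q * + 2
  lemma = solve-∀
... | 1           | a≡1+q*2 | _ = divides (a / + 2) (trans (cong (_- + 1) a≡1+q*2) (lemma (a / + 2)))
  where
  lemma : ∀ q → (+ 1 + q * + 2) - + 1 ≡ q * + 2
  lemma = solve-∀
... | suc (suc _) | _       | ℕ.s≤s (ℕ.s≤s ())

prime∣prime⇒≡ : Prime p → Prime n → p ℕ.∣ n → p ≡ n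
prime∣prime⇒≡ p-prime n-prime p∣n with prime⇒irreducible n-prime p∣n
... | inj₁ p≡1 = contradiction p≡1 (nonTrivial⇒≢1 {{prime⇒nonTrivial p-prime}})
... | inj₂ p≡n = p≡n

euclidsLemmaℤ : Prime p → + p ∣ₛ a * b → + p ∣ₛ a ⊎ + p ∣ₛ b
euclidsLemmaℤ {a = a} {b} p-prime p∣ab =
  Sum.map ∣ᵤ⇒∣ ∣ᵤ⇒∣ (euclidsLemma ∣ a ∣ ∣ b ∣ p-prime (subst (_ ℕ.∣_) (abs-* a b) (∣⇒∣ᵤ p∣ab)))

∣ab∧∤a⇒∣b : Prime p → ¬ + p ∣ₛ a → + p ∣ₛ a * b → + p ∣ₛ b
∣ab∧∤a⇒∣b p-prime p∤a p∣ab with euclidsLemmaℤ p-prime p∣ab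
... | inj₁ p∣a = contradiction p∣a p∤a
... | inj₂ p∣b = p∣b

∤a∧∤b⇒∤ab : Prime p → ¬ + p ∣ₛ a → ¬ + p ∣ₛ b → ¬ + p ∣ₛ a * b
∤a∧∤b⇒∤ab p-prime p∤a p∤b p∣ab = p∤b (∣ab∧∤a⇒∣b p-prime p∤a p∣ab)

pos-Bézout : ∀ a b c d → 1 ℕ.+ a ℕ.* b ≡ c ℕ.* d → + 1 + + a * + b ≡ + c * + d
pos-Bézout a b c d eq = begin
  + 1 + + a * + b      ≡⟨ cong (_+_ (+ 1)) (pos-* a b) ⟨
  + 1 + + (a ℕ.* b)    ≡⟨ pos-+ 1 (a ℕ.* b) ⟨
  + (1 ℕ.+ a ℕ.* b)    ≡⟨ cong +_ eq ⟩
  + (c ℕ.* d)          ≡⟨ pos-* c d ⟩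
  + c * + d            ∎
  where open ≡-Reasoning

inverse-mod : Prime p → ¬ + p ∣ₛ a → Σ ℤ λ u → + p ∣ₛ u * a - + 1
inverse-mod {p} {+ n} p-prime p∤n with coprime-Bézout coprime
  where
  coprime : Coprime p n
  coprime (d∣p , d∣n) with prime⇒irreducible p-prime d∣p
  ... | inj₁ d≡1 = d≡1
  ... | inj₂ refl = contradiction (∣ᵤ⇒∣ d∣n) p∤n
... | Bézout.+- x y 1+yn≡xp =
  - + y , subst (+ p ∣ₛ_) (lemma (+ y) (+ n)) (∣m⇒∣-m (divides (+ x) (pos-Bézout y n x p 1+yn≡xp)))
  where
  lemma : ∀ y n → - (+ 1 + y * n) ≡ (- y) * n - + 1
  lemma = solve-∀
... | Bézout.-+ x y 1+xp≡yn =
  + y , divides (+ x) (trans (cong (_- + 1) (sym (pos-Bézout x p y n 1+xp≡yn))) (lemma (+ x * + p)))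
  where
  lemma : ∀ s → (+ 1 + s) - + 1 ≡ s
  lemma = solve-∀
inverse-mod {p} { -[1+ n ]} p-prime p∤a with inverse-mod p-prime (λ p∣n → p∤a (∣m⇒∣-m p∣n))
... | u , p∣un-1 = - u , subst (λ v → + p ∣ₛ v - + 1) (lemma u (+ suc n)) p∣un-1
  where
  lemma : ∀ u m → u * m ≡ (- u) * (- m)
  lemma = solve-∀

proportional-coordinates : ∀ a a′ a″ b b′ b″ → Prime p → ¬ + p ∣ₛ a →
  + p ∣ₛ a * b′ - a′ * b → + p ∣ₛ a″ * b - a * b″ →
  Σ ℤ λ L → + p ∣ₛ b - L * a × + p ∣ₛ b′ - L * a′ × + p ∣ₛ b″ - L * a″
proportional-coordinates {p} a a′ a″ b b′ b″ p-prime p∤a p∣ab′-a′b p∣a″b-ab″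
  with inverse-mod p-prime p∤a
... | u , p∣ua-1 = L , p∣b-La , cancel p∣a[b′-La′] , cancel p∣a[b″-La″]
  where
  L : ℤ
  L = u * b
  lemma : ∀ a b u → (- b) * (u * a - + 1) ≡ b - (u * b) * a
  lemma = solve-∀
  lemma′ : ∀ a a′ b b′ L → (a * b′ - a′ * b) + a′ * (b - L * a) ≡ a * (b′ - L * a′)
  lemma′ = solve-∀
  lemma″ : ∀ a a″ b b″ L → - (a″ * b - a * b″) + a″ * (b - L * a) ≡ a * (b″ - L * a″)
  lemma″ = solve-∀
  p∣b-La : + p ∣ₛ b - L * a
  p∣b-La = subst (+ p ∣ₛ_) (lemma a b u) (∣n⇒∣m*n (- b) p∣ua-1)
  p∣a[b′-La′] : + p ∣ₛ a * (b′ - L * a′)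
  p∣a[b′-La′] = subst (+ p ∣ₛ_) (lemma′ a a′ b b′ L) (∣m∣n⇒∣m+n p∣ab′-a′b (∣n⇒∣m*n a′ p∣b-La))
  p∣a[b″-La″] : + p ∣ₛ a * (b″ - L * a″)
  p∣a[b″-La″] = subst (+ p ∣ₛ_) (lemma″ a a″ b b″ L) (∣m∣n⇒∣m+n (∣m⇒∣-m p∣a″b-ab″) (∣n⇒∣m*n a″ p∣b-La))
  cancel : + p ∣ₛ a * x → + p ∣ₛ x
  cancel = ∣ab∧∤a⇒∣b p-prime p∤a

conj : Quat → Quat
conj (quat a b c d) = quat a (- b) (- c) (- d)

sumSq : Quat → ℤ
sumSq (quat a b c d) = a * a + b * b + c * c + d * d

scalar : ℤ → Quat
scalar a = quat a (+ 0) (+ 0) (+ 0)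

quat-cong : ∀ {a b c d a′ b′ c′ d′} → a ≡ a′ → b ≡ b′ → c ≡ c′ → d ≡ d′ → quat a b c d ≡ quat a′ b′ c′ d′
quat-cong refl refl refl refl = refl

-- Evaluating the symbolic operations below at an
-- environment reduces definitionally to the integer quaternion operations, so an identity between
-- quaternion expressions follows from the ring solver applied to each coordinate.
record Quatᵖ (n : ℕ) : Set where
  constructor quatᵖ
  field
    reᵖ iiᵖ jjᵖ kkᵖ : Polynomial n
open Quatᵖ

module _ {n : ℕ} where

  infixl 7 _·ᵖ_
  infixl 6 _⊕ᵖ_
  infixr 8 _⋆ᵖ_

  _·ᵖ_ : Quatᵖ n → Quatᵖ n → Quatᵖ n
  quatᵖ a₁ b₁ c₁ d₁ ·ᵖ quatᵖ a₂ b₂ c₂ d₂ = quatᵖ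
    (a₁ :* a₂ :- b₁ :* b₂ :- c₁ :* c₂ :- d₁ :* d₂)
    (a₁ :* b₂ :+ b₁ :* a₂ :+ c₁ :* d₂ :- d₁ :* c₂)
    (a₁ :* c₂ :- b₁ :* d₂ :+ c₁ :* a₂ :+ d₁ :* b₂)
    (a₁ :* d₂ :+ b₁ :* c₂ :- c₁ :* b₂ :+ d₁ :* a₂)

  _⊕ᵖ_ : Quatᵖ n → Quatᵖ n → Quatᵖ n
  quatᵖ a₁ b₁ c₁ d₁ ⊕ᵖ quatᵖ a₂ b₂ c₂ d₂ = quatᵖ (a₁ :+ a₂) (b₁ :+ b₂) (c₁ :+ c₂) (d₁ :+ d₂)

  _⋆ᵖ_ : Polynomial n → Quatᵖ n → Quatᵖ n
  k ⋆ᵖ quatᵖ a b c d = quatᵖ (k :* a) (k :* b) (k :* c) (k :* d)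

  conjᵖ : Quatᵖ n → Quatᵖ n
  conjᵖ (quatᵖ a b c d) = quatᵖ a (:- b) (:- c) (:- d)

  scalarᵖ : Polynomial n → Quatᵖ n
  scalarᵖ a = quatᵖ a (con (+ 0)) (con (+ 0)) (con (+ 0))

  sumSqᵖ : Quatᵖ n → Polynomial n
  sumSqᵖ (quatᵖ a b c d) = a :* a :+ b :* b :+ c :* c :+ d :* d

  ⟦_⟧ᵠ : Quatᵖ n → Vec ℤ n → Quat
  ⟦ quatᵖ a b c d ⟧ᵠ ρ = quat (⟦ a ⟧ ρ) (⟦ b ⟧ ρ) (⟦ c ⟧ ρ) (⟦ d ⟧ ρ)

  quat-identity : (ρ : Vec ℤ n) (X Y : Quatᵖ n) →
    ⟦ reᵖ X ⟧↓ ρ ≡ ⟦ reᵖ Y ⟧↓ ρ → ⟦ iiᵖ X ⟧↓ ρ ≡ ⟦ iiᵖ Y ⟧↓ ρ →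
    ⟦ jjᵖ X ⟧↓ ρ ≡ ⟦ jjᵖ Y ⟧↓ ρ → ⟦ kkᵖ X ⟧↓ ρ ≡ ⟦ kkᵖ Y ⟧↓ ρ →
    ⟦ X ⟧ᵠ ρ ≡ ⟦ Y ⟧ᵠ ρ
  quat-identity ρ X Y e₀ e₁ e₂ e₃ =
    quat-cong (prove ρ (reᵖ X) (reᵖ Y) e₀) (prove ρ (iiᵖ X) (iiᵖ Y) e₁)
              (prove ρ (jjᵖ X) (jjᵖ Y) e₂) (prove ρ (kkᵖ X) (kkᵖ Y) e₃)

env : Quat → Quat → Quat → ℤ → ℤ → Vec ℤ 14
env X Y Z a b = re X ∷ ii X ∷ jj X ∷ kk X ∷ re Y ∷ ii Y ∷ jj Y ∷ kk Y ∷ re Z ∷ ii Z ∷ jj Z ∷ kk Z ∷ a ∷ b ∷ []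

𝑿 𝒀 𝒁 : Quatᵖ 14
𝑿 = quatᵖ (var (# 0)) (var (# 1)) (var (# 2)) (var (# 3))
𝒀 = quatᵖ (var (# 4)) (var (# 5)) (var (# 6)) (var (# 7))
𝒁 = quatᵖ (var (# 8)) (var (# 9)) (var (# 10)) (var (# 11))

𝟎 : Quatᵖ 14
𝟎 = scalarᵖ (con (+ 0))

𝒂 𝒃 : Polynomial 14
𝒂 = var (# 12)
𝒃 = var (# 13)

private
  variable
    X Y Z X′ Y′ : Quat

·ℤ-assoc : ∀ X Y Z → (X ·ℤ Y) ·ℤ Z ≡ X ·ℤ (Y ·ℤ Z)
·ℤ-assoc X Y Z = quat-identity (env X Y Z (+ 0) (+ 0)) (𝑿 ·ᵖ 𝒀 ·ᵖ 𝒁) (𝑿 ·ᵖ (𝒀 ·ᵖ 𝒁)) refl refl refl refl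

conj-·ℤ : ∀ X Y → conj (X ·ℤ Y) ≡ conj Y ·ℤ conj X
conj-·ℤ X Y = quat-identity (env X Y zeroH (+ 0) (+ 0)) (conjᵖ (𝑿 ·ᵖ 𝒀)) (conjᵖ 𝒀 ·ᵖ conjᵖ 𝑿) refl refl refl refl

·ℤ-conjʳ : ∀ X → X ·ℤ conj X ≡ scalar (sumSq X)
·ℤ-conjʳ X = quat-identity (env X zeroH zeroH (+ 0) (+ 0)) (𝑿 ·ᵖ conjᵖ 𝑿) (scalarᵖ (sumSqᵖ 𝑿)) refl refl refl refl

·ℤ-conjˡ : ∀ X → conj X ·ℤ X ≡ scalar (sumSq X)
·ℤ-conjˡ X = quat-identity (env X zeroH zeroH (+ 0) (+ 0)) (conjᵖ 𝑿 ·ᵖ 𝑿) (scalarᵖ (sumSqᵖ 𝑿)) refl refl refl refl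

scalar-·ℤ : ∀ a X → scalar a ·ℤ X ≡ a ⋆ X
scalar-·ℤ a X = quat-identity (env X zeroH zeroH a (+ 0)) (scalarᵖ 𝒂 ·ᵖ 𝑿) (𝒂 ⋆ᵖ 𝑿) refl refl refl refl

·ℤ-scalar : ∀ a X → X ·ℤ scalar a ≡ a ⋆ X
·ℤ-scalar a X = quat-identity (env X zeroH zeroH a (+ 0)) (𝑿 ·ᵖ scalarᵖ 𝒂) (𝒂 ⋆ᵖ 𝑿) refl refl refl refl

⋆-·ℤ : ∀ a X Y → (a ⋆ X) ·ℤ Y ≡ a ⋆ (X ·ℤ Y)
⋆-·ℤ a X Y = quat-identity (env X Y zeroH a (+ 0)) (𝒂 ⋆ᵖ 𝑿 ·ᵖ 𝒀) (𝒂 ⋆ᵖ (𝑿 ·ᵖ 𝒀)) refl refl refl refl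

·ℤ-⋆ : ∀ a X Y → X ·ℤ (a ⋆ Y) ≡ a ⋆ (X ·ℤ Y)
·ℤ-⋆ a X Y = quat-identity (env X Y zeroH a (+ 0)) (𝑿 ·ᵖ (𝒂 ⋆ᵖ 𝒀)) (𝒂 ⋆ᵖ (𝑿 ·ᵖ 𝒀)) refl refl refl refl

⋆-⋆ : ∀ a b X → a ⋆ (b ⋆ X) ≡ (a * b) ⋆ X
⋆-⋆ a b X = quat-identity (env X zeroH zeroH a b) (𝒂 ⋆ᵖ 𝒃 ⋆ᵖ 𝑿) ((𝒂 :* 𝒃) ⋆ᵖ 𝑿) refl refl refl refl

conj-⋆ : ∀ a X → conj (a ⋆ X) ≡ a ⋆ conj X
conj-⋆ a X = quat-identity (env X zeroH zeroH a (+ 0)) (conjᵖ (𝒂 ⋆ᵖ 𝑿)) (𝒂 ⋆ᵖ conjᵖ 𝑿) refl refl refl refl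

⋆-scalar : ∀ a b → a ⋆ scalar b ≡ scalar (a * b)
⋆-scalar a b = quat-cong refl (*-zeroʳ a) (*-zeroʳ a) (*-zeroʳ a)

re-·ℤ-comm : ∀ X Y → re (X ·ℤ Y) ≡ re (Y ·ℤ X)
re-·ℤ-comm X Y = prove (env X Y zeroH (+ 0) (+ 0)) (reᵖ (𝑿 ·ᵖ 𝒀)) (reᵖ (𝒀 ·ᵖ 𝑿)) refl

module Congruence (m : ℤ) where

  infix 4 _≈_ _≋_

  record _≈_ (X Y : Quat) : Set where
    constructor _,_
    field
      quotient : Quat
      ≡+m⋆quotient : X ≡ Y ⊕ (m ⋆ quotient)

  record _≋_ (X Y : Quat) : Set where
    constructor coordinatewise
    field
      re-∣ : m ∣ₛ re X - re Y
      ii-∣ : m ∣ₛ ii X - ii Y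
      jj-∣ : m ∣ₛ jj X - jj Y
      kk-∣ : m ∣ₛ kk X - kk Y

  ≈⇒≋ : X ≈ Y → X ≋ Y
  ≈⇒≋ {Y = Y} (D , refl) = coordinatewise
    (x≡y+md⇒m∣x-y (re Y) (re D) refl) (x≡y+md⇒m∣x-y (ii Y) (ii D) refl)
    (x≡y+md⇒m∣x-y (jj Y) (jj D) refl) (x≡y+md⇒m∣x-y (kk Y) (kk D) refl)

  ≋⇒≈ : X ≋ Y → X ≈ Y
  ≋⇒≈ (coordinatewise (divides d₀ e₀) (divides d₁ e₁) (divides d₂ e₂) (divides d₃ e₃)) =
    quat d₀ d₁ d₂ d₃ , quat-cong (x-y≡dm⇒x≡y+md d₀ e₀) (x-y≡dm⇒x≡y+md d₁ e₁)
                                 (x-y≡dm⇒x≡y+md d₂ e₂) (x-y≡dm⇒x≡y+md d₃ e₃)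

  ≈-reflexive : X ≡ Y → X ≈ Y
  ≈-reflexive {X} refl = zeroH , quat-identity (env X zeroH zeroH m (+ 0)) 𝑿 (𝑿 ⊕ᵖ 𝒂 ⋆ᵖ 𝟎) refl refl refl refl

  ≈-sym : X ≈ Y → Y ≈ X
  ≈-sym {Y = Y} (D , refl) = (- + 1) ⋆ D ,
    quat-identity (env Y D zeroH m (+ 0)) 𝑿 (𝑿 ⊕ᵖ 𝒂 ⋆ᵖ 𝒀 ⊕ᵖ 𝒂 ⋆ᵖ (:- con (+ 1)) ⋆ᵖ 𝒀) refl refl refl refl

  ≈-trans : X ≈ Y → Y ≈ Z → X ≈ Z
  ≈-trans {Z = Z} (D , refl) (E , refl) = E ⊕ D ,
    quat-identity (env Z E D m (+ 0)) (𝑿 ⊕ᵖ 𝒂 ⋆ᵖ 𝒀 ⊕ᵖ 𝒂 ⋆ᵖ 𝒁) (𝑿 ⊕ᵖ 𝒂 ⋆ᵖ (𝒀 ⊕ᵖ 𝒁)) refl refl refl refl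

  ≈-setoid : Setoid 0ℓ 0ℓ
  ≈-setoid = record
    { Carrier = Quat
    ; _≈_ = _≈_
    ; isEquivalence = record { refl = ≈-reflexive refl ; sym = ≈-sym ; trans = ≈-trans }
    }

  module ≈-Reasoning = SetoidReasoning ≈-setoid

  ≈-⋆ : ∀ a → X ≈ Y → a ⋆ X ≈ a ⋆ Y
  ≈-⋆ {Y = Y} a (D , refl) = a ⋆ D ,
    quat-identity (env Y D zeroH m a) (𝒃 ⋆ᵖ (𝑿 ⊕ᵖ 𝒂 ⋆ᵖ 𝒀)) (𝒃 ⋆ᵖ 𝑿 ⊕ᵖ 𝒂 ⋆ᵖ 𝒃 ⋆ᵖ 𝒀) refl refl refl refl

  ≈-·ℤˡ : ∀ Z → X ≈ Y → X ·ℤ Z ≈ Y ·ℤ Z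
  ≈-·ℤˡ {Y = Y} Z (D , refl) = D ·ℤ Z ,
    quat-identity (env Y D Z m (+ 0)) ((𝑿 ⊕ᵖ 𝒂 ⋆ᵖ 𝒀) ·ᵖ 𝒁) (𝑿 ·ᵖ 𝒁 ⊕ᵖ 𝒂 ⋆ᵖ (𝒀 ·ᵖ 𝒁)) refl refl refl refl

  ≈-·ℤʳ : ∀ Z → X ≈ Y → Z ·ℤ X ≈ Z ·ℤ Y
  ≈-·ℤʳ {Y = Y} Z (D , refl) = Z ·ℤ D ,
    quat-identity (env Y D Z m (+ 0)) (𝒁 ·ᵖ (𝑿 ⊕ᵖ 𝒂 ⋆ᵖ 𝒀)) (𝒁 ·ᵖ 𝑿 ⊕ᵖ 𝒂 ⋆ᵖ (𝒁 ·ᵖ 𝒀)) refl refl refl refl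

  ≈-·ℤ : X ≈ X′ → Y ≈ Y′ → X ·ℤ Y ≈ X′ ·ℤ Y′
  ≈-·ℤ {X′ = X′} {Y = Y} X≈X′ Y≈Y′ = ≈-trans (≈-·ℤˡ Y X≈X′) (≈-·ℤʳ X′ Y≈Y′)

  ≈-conj : X ≈ Y → conj X ≈ conj Y
  ≈-conj {Y = Y} (D , refl) = conj D ,
    quat-identity (env Y D zeroH m (+ 0)) (conjᵖ (𝑿 ⊕ᵖ 𝒂 ⋆ᵖ 𝒀)) (conjᵖ 𝑿 ⊕ᵖ 𝒂 ⋆ᵖ conjᵖ 𝒀) refl refl refl refl

  ∣⇒≈zeroH : m ∣ₛ re X → m ∣ₛ ii X → m ∣ₛ jj X → m ∣ₛ kk X → X ≈ zeroH
  ∣⇒≈zeroH m∣x₀ m∣x₁ m∣x₂ m∣x₃ = ≋⇒≈ (coordinatewise (∣-0 m∣x₀) (∣-0 m∣x₁) (∣-0 m∣x₂) (∣-0 m∣x₃))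
    where
    ∣-0 : m ∣ₛ x → m ∣ₛ x - + 0
    ∣-0 {x} = subst (m ∣ₛ_) (sym (+-identityʳ x))

  ≈zeroH⇒∣ : X ≈ zeroH → m ∣ₛ re X × m ∣ₛ ii X × m ∣ₛ jj X × m ∣ₛ kk X
  ≈zeroH⇒∣ X≈0 with ≈⇒≋ X≈0
  ... | coordinatewise m∣x₀ m∣x₁ m∣x₂ m∣x₃ = ∣-0 m∣x₀ , ∣-0 m∣x₁ , ∣-0 m∣x₂ , ∣-0 m∣x₃
    where
    ∣-0 : m ∣ₛ x - + 0 → m ∣ₛ x
    ∣-0 {x} = subst (m ∣ₛ_) (+-identityʳ x)

  ∣⇒⋆≈zeroH : m ∣ₛ a → a ⋆ X ≈ zeroH
  ∣⇒⋆≈zeroH {X = X} m∣a = ∣⇒≈zeroH (∣m⇒∣m*n (re X) m∣a) (∣m⇒∣m*n (ii X) m∣a) (∣m⇒∣m*n (jj X) m∣a) (∣m⇒∣m*n (kk X) m∣a)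

  ≈⇒re-∣ : X ≈ Y → m ∣ₛ re Y → m ∣ₛ re X
  ≈⇒re-∣ {X} {Y} X≈Y m∣y₀ = subst (m ∣ₛ_) (lemma (re X) (re Y)) (∣m∣n⇒∣m+n (_≋_.re-∣ (≈⇒≋ X≈Y)) m∣y₀)
    where
    lemma : ∀ x y → (x - y) + y ≡ x
    lemma = solve-∀

  scalar-≈ : m ∣ₛ a - b → scalar a ≈ scalar b
  scalar-≈ m∣a-b = ≋⇒≈ (coordinatewise m∣a-b (divides (+ 0) refl) (divides (+ 0) refl) (divides (+ 0) refl))

  ·ℤ-conj≈zeroH : ∀ X → m ∣ₛ sumSq X → X ·ℤ conj X ≈ zeroH
  ·ℤ-conj≈zeroH X m∣N = ≈-trans (≈-reflexive (·ℤ-conjʳ X)) (scalar-≈ (subst (m ∣ₛ_) (sym (+-identityʳ (sumSq X))) m∣N))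

  conj≈-1⋆ : ∀ X → m ∣ₛ re X → conj X ≈ (- + 1) ⋆ X
  conj≈-1⋆ X m∣x₀ = ≋⇒≈ (coordinatewise (subst (m ∣ₛ_) (lemma₀ (re X)) (∣n⇒∣m*n (+ 2) m∣x₀))
    (divides (+ 0) (lemma (ii X) m)) (divides (+ 0) (lemma (jj X) m)) (divides (+ 0) (lemma (kk X) m)))
    where
    lemma₀ : ∀ x → + 2 * x ≡ x - (- + 1) * x
    lemma₀ = solve-∀
    lemma : ∀ x m → (- x) - (- + 1) * x ≡ + 0 * m
    lemma = solve-∀

  re-conjugate-∣ : ∀ c Q Qi X → Q ·ℤ Qi ≈ scalar c → m ∣ₛ re X → m ∣ₛ re ((Qi ·ℤ X) ·ℤ Q)
  re-conjugate-∣ c Q Qi X QQi≈c m∣x₀ = subst (m ∣ₛ_) (sym re-cycle) (≈⇒re-∣ QQiX≈cX (∣n⇒∣m*n c m∣x₀))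
    where
    re-cycle : re ((Qi ·ℤ X) ·ℤ Q) ≡ re ((Q ·ℤ Qi) ·ℤ X)
    re-cycle = trans (re-·ℤ-comm (Qi ·ℤ X) Q) (cong re (sym (·ℤ-assoc Q Qi X)))
    QQiX≈cX : (Q ·ℤ Qi) ·ℤ X ≈ c ⋆ X
    QQiX≈cX = ≈-trans (≈-·ℤˡ X QQi≈c) (≈-reflexive (scalar-·ℤ c X))

  2⋆conjugate≈ : ∀ P Q Q′ P′ H Qi t → (+ 2) ⋆ t ≈ H ·ℤ P → P ·ℤ Q ≡ Q′ ·ℤ P′ →
                 (+ 2) ⋆ ((Qi ·ℤ t) ·ℤ Q) ≈ ((Qi ·ℤ H) ·ℤ Q′) ·ℤ P′
  2⋆conjugate≈ P Q Q′ P′ H Qi t 2t≈HP PQ≡Q′P′ = begin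
    (+ 2) ⋆ ((Qi ·ℤ t) ·ℤ Q)      ≡⟨ trans (cong (_·ℤ Q) (·ℤ-⋆ (+ 2) Qi t)) (⋆-·ℤ (+ 2) (Qi ·ℤ t) Q) ⟨
    (Qi ·ℤ ((+ 2) ⋆ t)) ·ℤ Q      ≈⟨ ≈-·ℤˡ Q (≈-·ℤʳ Qi 2t≈HP) ⟩
    (Qi ·ℤ (H ·ℤ P)) ·ℤ Q         ≡⟨ trans (cong (_·ℤ Q) (sym (·ℤ-assoc Qi H P))) (·ℤ-assoc (Qi ·ℤ H) P Q) ⟩
    (Qi ·ℤ H) ·ℤ (P ·ℤ Q)         ≡⟨ cong ((Qi ·ℤ H) ·ℤ_) PQ≡Q′P′ ⟩
    (Qi ·ℤ H) ·ℤ (Q′ ·ℤ P′)       ≡⟨ ·ℤ-assoc (Qi ·ℤ H) Q′ P′ ⟨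
    ((Qi ·ℤ H) ·ℤ Q′) ·ℤ P′       ∎
    where open ≈-Reasoning

  -2⋆≈conj : ∀ P′ H′ t′ → (+ 2) ⋆ t′ ≈ H′ ·ℤ P′ → m ∣ₛ re t′ → (- + 2) ⋆ t′ ≈ conj P′ ·ℤ conj H′
  -2⋆≈conj P′ H′ t′ 2t′≈H′P′ m∣t′₀ = begin
    (- + 2) ⋆ t′               ≡⟨ ⋆-⋆ (+ 2) (- + 1) t′ ⟨
    (+ 2) ⋆ ((- + 1) ⋆ t′)     ≈⟨ ≈-⋆ (+ 2) (conj≈-1⋆ t′ m∣t′₀) ⟨
    (+ 2) ⋆ conj t′            ≡⟨ conj-⋆ (+ 2) t′ ⟨
    conj ((+ 2) ⋆ t′)          ≈⟨ ≈-conj 2t′≈H′P′ ⟩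
    conj (H′ ·ℤ P′)            ≡⟨ conj-·ℤ H′ P′ ⟩
    conj P′ ·ℤ conj H′         ∎
    where open ≈-Reasoning

-- In the doubled encoding, the Hurwitz integer a(1+i+j+k)/2 + m₁i + m₂j + m₃k.
form : ℤ → ℤ → ℤ → ℤ → Quat
form a m₁ m₂ m₃ = quat a (a + + 2 * m₁) (a + + 2 * m₂) (a + + 2 * m₃)

formᵖ : ∀ {n} → Polynomial n → Polynomial n → Polynomial n → Polynomial n → Quatᵖ n
formᵖ a m₁ m₂ m₃ = quatᵖ a (a :+ con (+ 2) :* m₁) (a :+ con (+ 2) :* m₂) (a :+ con (+ 2) :* m₃)

form-hurwitz : ∀ a m₁ m₂ m₃ → Hurwitz (form a m₁ m₂ m₃)
form-hurwitz a m₁ m₂ m₃ with + 2 ∣ₛ? a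
... | yes 2∣a = inj₁ (∣⇒∣ᵤ 2∣a , even m₁ , even m₂ , even m₃)
  where
  even : ∀ k → Even (a + + 2 * k)
  even k = ∣⇒∣ᵤ (∣m∣n⇒∣m+n 2∣a (∣m⇒∣m*n k ∣-refl))
... | no 2∤a = inj₂ (2∤a ∘ ∣ᵤ⇒∣ {i = a} , odd m₁ , odd m₂ , odd m₃)
  where
  odd : ∀ k → Odd (a + + 2 * k)
  odd k 2∣a+2k = 2∤a (∣m+n∣n⇒∣m (∣ᵤ⇒∣ {i = a + + 2 * k} 2∣a+2k) (∣m⇒∣m*n k ∣-refl))

hurwitz⇒form : ∀ X → Hurwitz X → Σ ℤ λ a → Σ ℤ λ m₁ → Σ ℤ λ m₂ → Σ ℤ λ m₃ → X ≡ form a m₁ m₂ m₃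
hurwitz⇒form X h with same-parity h
  where
  same-parity : Hurwitz X → + 2 ∣ₛ ii X - re X × + 2 ∣ₛ jj X - re X × + 2 ∣ₛ kk X - re X
  same-parity (inj₁ (2∣x₀ , 2∣x₁ , 2∣x₂ , 2∣x₃)) = both-even (ii X) 2∣x₁ , both-even (jj X) 2∣x₂ , both-even (kk X) 2∣x₃
    where
    both-even : ∀ x → Even x → + 2 ∣ₛ x - re X
    both-even x 2∣x = ∣m∣n⇒∣m-n (∣ᵤ⇒∣ {i = x} 2∣x) (∣ᵤ⇒∣ {i = re X} 2∣x₀)
  same-parity (inj₂ (2∤x₀ , 2∤x₁ , 2∤x₂ , 2∤x₃)) = both-odd (ii X) 2∤x₁ , both-odd (jj X) 2∤x₂ , both-odd (kk X) 2∤x₃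
    where
    lemma : ∀ x y → (x - + 1) - (y - + 1) ≡ x - y
    lemma = solve-∀
    both-odd : ∀ x → Odd x → + 2 ∣ₛ x - re X
    both-odd x 2∤x = subst (+ 2 ∣ₛ_) (lemma x (re X)) (∣m∣n⇒∣m-n (odd⇒2∣pred {x} 2∤x) (odd⇒2∣pred {re X} 2∤x₀))
... | divides m₁ e₁ , divides m₂ e₂ , divides m₃ e₃ =
  re X , m₁ , m₂ , m₃ , quat-cong refl (x-y≡dm⇒x≡y+md m₁ e₁) (x-y≡dm⇒x≡y+md m₂ e₂) (x-y≡dm⇒x≡y+md m₃ e₃)

zeroH-hurwitz : Hurwitz zeroH
zeroH-hurwitz = form-hurwitz (+ 0) (+ 0) (+ 0) (+ 0)

oneH-hurwitz : Hurwitz oneH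
oneH-hurwitz = form-hurwitz (+ 2) (- + 1) (- + 1) (- + 1)

⋆-form : ∀ k a m₁ m₂ m₃ → k ⋆ form a m₁ m₂ m₃ ≡ form (k * a) (k * m₁) (k * m₂) (k * m₃)
⋆-form k a m₁ m₂ m₃ = quat-cong refl (lemma k a m₁) (lemma k a m₂) (lemma k a m₃)
  where
  lemma : ∀ k a m → k * (a + + 2 * m) ≡ k * a + + 2 * (k * m)
  lemma = solve-∀

conj-form : ∀ a m₁ m₂ m₃ → conj (form a m₁ m₂ m₃) ≡ form a (- a - m₁) (- a - m₂) (- a - m₃)
conj-form a m₁ m₂ m₃ = quat-cong refl (lemma a m₁) (lemma a m₂) (lemma a m₃)
  where
  lemma : ∀ a m → - (a + + 2 * m) ≡ a + + 2 * (- a - m)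
  lemma = solve-∀

⋆-hurwitz : ∀ k X → Hurwitz X → Hurwitz (k ⋆ X)
⋆-hurwitz k X h with hurwitz⇒form X h
... | a , m₁ , m₂ , m₃ , refl =
  subst Hurwitz (sym (⋆-form k a m₁ m₂ m₃)) (form-hurwitz (k * a) (k * m₁) (k * m₂) (k * m₃))

conj-hurwitz : ∀ X → Hurwitz X → Hurwitz (conj X)
conj-hurwitz X h with hurwitz⇒form X h
... | a , m₁ , m₂ , m₃ , refl =
  subst Hurwitz (sym (conj-form a m₁ m₂ m₃)) (form-hurwitz a (- a - m₁) (- a - m₂) (- a - m₃))

form-·ℤ-form : ∀ a m₁ m₂ m₃ b n₁ n₂ n₃ → Σ ℤ λ c → Σ ℤ λ e₁ → Σ ℤ λ e₂ → Σ ℤ λ e₃ →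
  form a m₁ m₂ m₃ ·ℤ form b n₁ n₂ n₃ ≡ (+ 2) ⋆ form c e₁ e₂ e₃
form-·ℤ-form a m₁ m₂ m₃ b n₁ n₂ n₃ =
  ⟦ γ ⟧ ρ , ⟦ ε₁ ⟧ ρ , ⟦ ε₂ ⟧ ρ , ⟦ ε₃ ⟧ ρ ,
  quat-identity ρ (formᵖ α μ₁ μ₂ μ₃ ·ᵖ formᵖ β ν₁ ν₂ ν₃) (con (+ 2) ⋆ᵖ formᵖ γ ε₁ ε₂ ε₃) refl refl refl refl
  where
  ρ : Vec ℤ 8
  ρ = a ∷ m₁ ∷ m₂ ∷ m₃ ∷ b ∷ n₁ ∷ n₂ ∷ n₃ ∷ []
  α μ₁ μ₂ μ₃ β ν₁ ν₂ ν₃ γ ε₁ ε₂ ε₃ : Polynomial 8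
  α = var (# 0)
  μ₁ = var (# 1)
  μ₂ = var (# 2)
  μ₃ = var (# 3)
  β = var (# 4)
  ν₁ = var (# 5)
  ν₂ = var (# 6)
  ν₃ = var (# 7)
  γ = :- α :* β :- α :* (ν₁ :+ ν₂ :+ ν₃) :- β :* (μ₁ :+ μ₂ :+ μ₃) :- con (+ 2) :* (μ₁ :* ν₁ :+ μ₂ :* ν₂ :+ μ₃ :* ν₃)
  ε₁ = α :* β :+ α :* (ν₁ :+ ν₃) :+ β :* (μ₁ :+ μ₂) :+ μ₁ :* ν₁ :+ μ₂ :* ν₂ :+ μ₂ :* ν₃ :- μ₃ :* ν₂ :+ μ₃ :* ν₃
  ε₂ = α :* β :+ α :* (ν₁ :+ ν₂) :+ β :* (μ₂ :+ μ₃) :+ μ₁ :* ν₁ :- μ₁ :* ν₃ :+ μ₂ :* ν₂ :+ μ₃ :* ν₁ :+ μ₃ :* ν₃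
  ε₃ = α :* β :+ α :* (ν₂ :+ ν₃) :+ β :* (μ₁ :+ μ₃) :+ μ₁ :* ν₁ :+ μ₁ :* ν₂ :- μ₂ :* ν₁ :+ μ₂ :* ν₂ :+ μ₃ :* ν₃

half-double : ∀ x → half (+ 2 * x) ≡ x
half-double x = trans (cong half (*-comm (+ 2) x)) ([k*n]/n≡k x 1)

·ℤ≡2⋆⇒⊗≡ : ∀ X Y W → X ·ℤ Y ≡ (+ 2) ⋆ W → X ⊗ Y ≡ W
·ℤ≡2⋆⇒⊗≡ X Y W XY≡2W = quat-cong (halve (cong re XY≡2W)) (halve (cong ii XY≡2W))
                                 (halve (cong jj XY≡2W)) (halve (cong kk XY≡2W))
  where
  halve : x ≡ + 2 * y → half x ≡ y
  halve {y = y} refl = half-double y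

-- This makes the halving in _⊗_ exact on Hurwitz integers.
·ℤ-hurwitz : ∀ X Y → Hurwitz X → Hurwitz Y → Σ Quat λ W → Hurwitz W × X ·ℤ Y ≡ (+ 2) ⋆ W
·ℤ-hurwitz X Y hX hY with hurwitz⇒form X hX | hurwitz⇒form Y hY
... | a , m₁ , m₂ , m₃ , refl | b , n₁ , n₂ , n₃ , refl =
  let c , e₁ , e₂ , e₃ , XY≡2W = form-·ℤ-form a m₁ m₂ m₃ b n₁ n₂ n₃
  in form c e₁ e₂ e₃ , form-hurwitz c e₁ e₂ e₃ , XY≡2W

⊗-hurwitz : ∀ X Y → Hurwitz X → Hurwitz Y → Hurwitz (X ⊗ Y)
⊗-hurwitz X Y hX hY with ·ℤ-hurwitz X Y hX hY
... | W , hW , XY≡2W = subst Hurwitz (sym (·ℤ≡2⋆⇒⊗≡ X Y W XY≡2W)) hW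

2⋆⊗≡·ℤ : ∀ X Y → Hurwitz X → Hurwitz Y → (+ 2) ⋆ (X ⊗ Y) ≡ X ·ℤ Y
2⋆⊗≡·ℤ X Y hX hY with ·ℤ-hurwitz X Y hX hY
... | W , _ , XY≡2W = trans (cong ((+ 2) ⋆_) (·ℤ≡2⋆⇒⊗≡ X Y W XY≡2W)) (sym XY≡2W)

sumSq≡norm*4 : ∀ X → Hurwitz X → sumSq X ≡ norm X * + 4
sumSq≡norm*4 X h with hurwitz⇒form X h
... | a , m₁ , m₂ , m₃ , refl = begin
  sumSq X                ≡⟨ sumSq≡s*4 ⟩
  s * + 4                ≡⟨ cong (_* + 4) ([k*n]/n≡k s 3) ⟨
  (s * + 4) / + 4 * + 4  ≡⟨ cong (λ w → w / + 4 * + 4) sumSq≡s*4 ⟨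
  norm X * + 4           ∎
  where
  open ≡-Reasoning
  s : ℤ
  s = a * a + a * (m₁ + m₂ + m₃) + m₁ * m₁ + m₂ * m₂ + m₃ * m₃
  lemma : ∀ a m₁ m₂ m₃ →
    a * a + (a + + 2 * m₁) * (a + + 2 * m₁) + (a + + 2 * m₂) * (a + + 2 * m₂) + (a + + 2 * m₃) * (a + + 2 * m₃)
    ≡ (a * a + a * (m₁ + m₂ + m₃) + m₁ * m₁ + m₂ * m₂ + m₃ * m₃) * + 4
  lemma = solve-∀
  sumSq≡s*4 : sumSq X ≡ s * + 4
  sumSq≡s*4 = lemma a m₁ m₂ m₃

-- Only odd moduli: the parities of the coordinates of m D are those of X - Y, which agree.
hurwitz-quotient : ∀ {m} X Y D → ¬ + 2 ∣ₛ m → Hurwitz X → Hurwitz Y → X ≡ Y ⊕ (m ⋆ D) → Hurwitz D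
hurwitz-quotient {m} X Y D 2∤m hX hY X≡Y+mD with hurwitz⇒form X hX | hurwitz⇒form Y hY
... | a , m₁ , m₂ , m₃ , refl | b , n₁ , n₂ , n₃ , refl =
  subst Hurwitz (sym D≡form) (form-hurwitz d₀ (proj₁ r₁) (proj₁ r₂) (proj₁ r₃))
  where
  d₀ : ℤ
  d₀ = re D
  coordinate : ∀ u v {d} → a + + 2 * u ≡ (b + + 2 * v) + m * d → Σ ℤ λ r → d ≡ d₀ + + 2 * r
  coordinate u v {d} e with ∣ab∧∤a⇒∣b prime[2] 2∤m (divides (u - v) (begin
    m * (d - d₀)                                         ≡⟨ lemma₁ m d d₀ b v ⟩
    ((b + + 2 * v) + m * d) - (b + m * d₀) - + 2 * v     ≡⟨ cong₂ (λ s t → s - t - + 2 * v) e (cong re X≡Y+mD) ⟨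
    (a + + 2 * u) - a - + 2 * v                          ≡⟨ lemma₂ a u v ⟩
    (u - v) * + 2                                        ∎))
    where
    open ≡-Reasoning
    lemma₁ : ∀ m d d₀ b v → m * (d - d₀) ≡ ((b + + 2 * v) + m * d) - (b + m * d₀) - + 2 * v
    lemma₁ = solve-∀
    lemma₂ : ∀ a u v → (a + + 2 * u) - a - + 2 * v ≡ (u - v) * + 2
    lemma₂ = solve-∀
  ... | divides r d-d₀≡2r = r , x-y≡dm⇒x≡y+md r d-d₀≡2r
  r₁ : Σ ℤ λ r → ii D ≡ d₀ + + 2 * r
  r₁ = coordinate m₁ n₁ (cong ii X≡Y+mD)
  r₂ : Σ ℤ λ r → jj D ≡ d₀ + + 2 * r
  r₂ = coordinate m₂ n₂ (cong jj X≡Y+mD)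
  r₃ : Σ ℤ λ r → kk D ≡ d₀ + + 2 * r
  r₃ = coordinate m₃ n₃ (cong kk X≡Y+mD)
  D≡form : D ≡ form d₀ (proj₁ r₁) (proj₁ r₂) (proj₁ r₃)
  D≡form = quat-cong refl (proj₂ r₁) (proj₂ r₂) (proj₂ r₃)

module PrimeModulus (p : ℕ) (p-prime : Prime p) where

  open Congruence (+ p)

  ≈-cancel : ∀ c → ¬ + p ∣ₛ c → c ⋆ X ≈ c ⋆ Y → X ≈ Y
  ≈-cancel {X} {Y} c p∤c cX≈cY with ≈⇒≋ cX≈cY
  ... | coordinatewise p∣₀ p∣₁ p∣₂ p∣₃ =
    ≋⇒≈ (coordinatewise (cancel (re X) (re Y) p∣₀) (cancel (ii X) (ii Y) p∣₁)
                        (cancel (jj X) (jj Y) p∣₂) (cancel (kk X) (kk Y) p∣₃))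
    where
    lemma : ∀ c x y → c * x - c * y ≡ c * (x - y)
    lemma = solve-∀
    cancel : ∀ x y → + p ∣ₛ c * x - c * y → + p ∣ₛ x - y
    cancel x y p∣cx-cy = ∣ab∧∤a⇒∣b p-prime p∤c (subst (+ p ∣ₛ_) (lemma c x y) p∣cx-cy)

  ⋆≈zeroH⇒≈zeroH : ∀ c → ¬ + p ∣ₛ c → c ⋆ X ≈ zeroH → X ≈ zeroH
  ⋆≈zeroH⇒≈zeroH {X} c p∤c cX≈0 = ≈-cancel c p∤c (≈-trans cX≈0 (≈-reflexive (sym c⋆zeroH)))
    where
    c⋆zeroH : c ⋆ zeroH ≡ zeroH
    c⋆zeroH = quat-cong (*-zeroʳ c) (*-zeroʳ c) (*-zeroʳ c) (*-zeroʳ c)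

  conjugate-≉zeroH : ∀ c Q Qi X → Q ·ℤ Qi ≈ scalar c → ¬ + p ∣ₛ c → ¬ X ≈ zeroH → ¬ (Qi ·ℤ X) ·ℤ Q ≈ zeroH
  conjugate-≉zeroH c Q Qi X QQi≈c p∤c X≉0 S≈0 = X≉0 (⋆≈zeroH⇒≈zeroH (c * c) (∤a∧∤b⇒∤ab p-prime p∤c p∤c) (begin
    (c * c) ⋆ X                         ≡⟨ ⋆-⋆ c c X ⟨
    c ⋆ (c ⋆ X)                         ≡⟨ trans (·ℤ-scalar c (scalar c ·ℤ X)) (cong (c ⋆_) (scalar-·ℤ c X)) ⟨
    (scalar c ·ℤ X) ·ℤ scalar c         ≈⟨ ≈-·ℤ (≈-·ℤˡ X QQi≈c) QQi≈c ⟨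
    ((Q ·ℤ Qi) ·ℤ X) ·ℤ (Q ·ℤ Qi)       ≡⟨ cong (_·ℤ (Q ·ℤ Qi)) (·ℤ-assoc Q Qi X) ⟩
    (Q ·ℤ (Qi ·ℤ X)) ·ℤ (Q ·ℤ Qi)       ≡⟨ ·ℤ-assoc (Q ·ℤ (Qi ·ℤ X)) Q Qi ⟨
    ((Q ·ℤ (Qi ·ℤ X)) ·ℤ Q) ·ℤ Qi       ≡⟨ cong (_·ℤ Qi) (·ℤ-assoc Q (Qi ·ℤ X) Q) ⟩
    (Q ·ℤ ((Qi ·ℤ X) ·ℤ Q)) ·ℤ Qi       ≈⟨ ≈-·ℤˡ Qi (≈-·ℤʳ Q S≈0) ⟩
    (Q ·ℤ zeroH) ·ℤ Qi                  ≡⟨ quat-identity (env Q Qi zeroH (+ 0) (+ 0)) (𝑿 ·ᵖ 𝟎 ·ᵖ 𝒀) 𝟎 refl refl refl refl ⟩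
    zeroH                               ∎))
    where open ≈-Reasoning

  ≈⋆-coordinates : ∀ X Y L → + p ∣ₛ re X → + p ∣ₛ re Y →
    + p ∣ₛ ii Y - L * ii X → + p ∣ₛ jj Y - L * jj X → + p ∣ₛ kk Y - L * kk X → Y ≈ L ⋆ X
  ≈⋆-coordinates X Y L p∣x₀ p∣y₀ p∣₁ p∣₂ p∣₃ = ≋⇒≈ (coordinatewise (∣m∣n⇒∣m-n p∣y₀ (∣n⇒∣m*n L p∣x₀)) p∣₁ p∣₂ p∣₃)

  -- For pure quaternions XY = -X·Y + X×Y, so XY ≡ 0 forces the cross product X×Y to vanish mod p.
  cross-∣ : ∀ X Y → + p ∣ₛ re X → + p ∣ₛ re Y → X ·ℤ Y ≈ zeroH →
    + p ∣ₛ jj X * kk Y - kk X * jj Y × + p ∣ₛ kk X * ii Y - ii X * kk Y × + p ∣ₛ ii X * jj Y - jj X * ii Y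
  cross-∣ X Y p∣x₀ p∣y₀ XY≈0 with ≈zeroH⇒∣ XY≈0
  ... | _ , p∣i , p∣j , p∣k =
    drop (ii X) (ii Y) (prove ρ (iiᵖ (𝑿 ·ᵖ 𝒀)) (reᵖ 𝑿 :* iiᵖ 𝒀 :+ iiᵖ 𝑿 :* reᵖ 𝒀 :+ (jjᵖ 𝑿 :* kkᵖ 𝒀 :- kkᵖ 𝑿 :* jjᵖ 𝒀)) refl) p∣i ,
    drop (jj X) (jj Y) (prove ρ (jjᵖ (𝑿 ·ᵖ 𝒀)) (reᵖ 𝑿 :* jjᵖ 𝒀 :+ jjᵖ 𝑿 :* reᵖ 𝒀 :+ (kkᵖ 𝑿 :* iiᵖ 𝒀 :- iiᵖ 𝑿 :* kkᵖ 𝒀)) refl) p∣j ,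
    drop (kk X) (kk Y) (prove ρ (kkᵖ (𝑿 ·ᵖ 𝒀)) (reᵖ 𝑿 :* kkᵖ 𝒀 :+ kkᵖ 𝑿 :* reᵖ 𝒀 :+ (iiᵖ 𝑿 :* jjᵖ 𝒀 :- jjᵖ 𝑿 :* iiᵖ 𝒀)) refl) p∣k
    where
    ρ : Vec ℤ 14
    ρ = env X Y zeroH (+ 0) (+ 0)
    drop : ∀ {e c} x y → e ≡ re X * y + x * re Y + c → + p ∣ₛ e → + p ∣ₛ c
    drop x y refl p∣e = ∣m+n∣m⇒∣n p∣e (∣m∣n⇒∣m+n (∣m⇒∣m*n y p∣x₀) (∣n⇒∣m*n x p∣y₀))

  parallel-if-cross-∣ : ∀ X Y → ¬ X ≈ zeroH → + p ∣ₛ re X → + p ∣ₛ re Y →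
    + p ∣ₛ jj X * kk Y - kk X * jj Y → + p ∣ₛ kk X * ii Y - ii X * kk Y → + p ∣ₛ ii X * jj Y - jj X * ii Y →
    Σ ℤ λ L → Y ≈ L ⋆ X
  parallel-if-cross-∣ X Y X≉0 p∣x₀ p∣y₀ c₁ c₂ c₃ with + p ∣ₛ? ii X | + p ∣ₛ? jj X | + p ∣ₛ? kk X
  ... | no p∤x₁ | _ | _ =
    let L , d₁ , d₂ , d₃ = proportional-coordinates (ii X) (jj X) (kk X) (ii Y) (jj Y) (kk Y) p-prime p∤x₁ c₃ c₂
    in L , ≈⋆-coordinates X Y L p∣x₀ p∣y₀ d₁ d₂ d₃
  ... | yes _ | no p∤x₂ | _ =
    let L , d₂ , d₃ , d₁ = proportional-coordinates (jj X) (kk X) (ii X) (jj Y) (kk Y) (ii Y) p-prime p∤x₂ c₁ c₃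
    in L , ≈⋆-coordinates X Y L p∣x₀ p∣y₀ d₁ d₂ d₃
  ... | yes _ | yes _ | no p∤x₃ =
    let L , d₃ , d₁ , d₂ = proportional-coordinates (kk X) (ii X) (jj X) (kk Y) (ii Y) (jj Y) p-prime p∤x₃ c₂ c₁
    in L , ≈⋆-coordinates X Y L p∣x₀ p∣y₀ d₁ d₂ d₃
  ... | yes p∣x₁ | yes p∣x₂ | yes p∣x₃ = ⊥-elim (X≉0 (∣⇒≈zeroH p∣x₀ p∣x₁ p∣x₂ p∣x₃))

  proportional : ∀ X Y → ¬ X ≈ zeroH → + p ∣ₛ re X → + p ∣ₛ re Y → X ·ℤ Y ≈ zeroH → Σ ℤ λ L → Y ≈ L ⋆ X
  proportional X Y X≉0 p∣x₀ p∣y₀ XY≈0 =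
    let c₁ , c₂ , c₃ = cross-∣ X Y p∣x₀ p∣y₀ XY≈0 in parallel-if-cross-∣ X Y X≉0 p∣x₀ p∣y₀ c₁ c₂ c₃

module OddPrime (p : ℕ) (p-prime : Prime p) (p-odd : ¬ (+ 2 ∣ + p)) where

  open Congruence (+ p)
  open PrimeModulus p p-prime

  p∤2 : ¬ + p ∣ₛ + 2
  p∤2 p∣2 = p-odd (subst (λ n → + 2 ∣ + n) (sym (prime∣prime⇒≡ p-prime prime[2] (∣⇒∣ᵤ p∣2))) ℕ.∣-refl)

  p∤4 : ¬ + p ∣ₛ + 4
  p∤4 = ∤a∧∤b⇒∤ab p-prime p∤2 p∤2

  CongMod⇒≈ : CongMod p X Y → X ≈ Y
  CongMod⇒≈ (D , _ , X≡Y+pD) = D , X≡Y+pD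

  ≈⇒CongMod : ∀ X Y → Hurwitz X → Hurwitz Y → X ≈ Y → CongMod p X Y
  ≈⇒CongMod X Y hX hY (D , X≡Y+pD) = D , hurwitz-quotient {+ p} X Y D (p-odd ∘ ∣⇒∣ᵤ) hX hY X≡Y+pD , X≡Y+pD

  ·ℤ≈2⋆⇒⊗-CongMod : ∀ X Y Z → Hurwitz X → Hurwitz Y → Hurwitz Z → X ·ℤ Y ≈ (+ 2) ⋆ Z → CongMod p (X ⊗ Y) Z
  ·ℤ≈2⋆⇒⊗-CongMod X Y Z hX hY hZ XY≈2Z = ≈⇒CongMod (X ⊗ Y) Z (⊗-hurwitz X Y hX hY) hZ
    (≈-cancel (+ 2) p∤2 (≈-trans (≈-reflexive (2⋆⊗≡·ℤ X Y hX hY)) XY≈2Z))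

  CongMod-⊗⇒2⋆≈·ℤ : ∀ X Y Z → Hurwitz Y → Hurwitz Z → CongMod p X (Y ⊗ Z) → (+ 2) ⋆ X ≈ Y ·ℤ Z
  CongMod-⊗⇒2⋆≈·ℤ X Y Z hY hZ X≈YZ = ≈-trans (≈-⋆ (+ 2) (CongMod⇒≈ X≈YZ)) (≈-reflexive (2⋆⊗≡·ℤ Y Z hY hZ))

  ⊗-CongMod⇒·ℤ≈2⋆ : ∀ X Y Z → Hurwitz X → Hurwitz Y → CongMod p (X ⊗ Y) Z → X ·ℤ Y ≈ (+ 2) ⋆ Z
  ⊗-CongMod⇒·ℤ≈2⋆ X Y Z hX hY XY≈Z = ≈-trans (≈-reflexive (sym (2⋆⊗≡·ℤ X Y hX hY))) (≈-⋆ (+ 2) (CongMod⇒≈ XY≈Z))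

  invertible-mod : ∀ Q → Hurwitz Q → ¬ + p ∣ₛ norm Q → Σ Quat λ Qi → InvMod p Q Qi
  invertible-mod Q hQ p∤N with inverse-mod p-prime p∤N
  ... | u , p∣uN-1 = Qi , hQi , ·ℤ≈2⋆⇒⊗-CongMod Q Qi oneH hQ hQi oneH-hurwitz QQi≈4 ,
                              ·ℤ≈2⋆⇒⊗-CongMod Qi Q oneH hQi hQ oneH-hurwitz QiQ≈4
    where
    Qi : Quat
    Qi = u ⋆ conj Q
    hQi : Hurwitz Qi
    hQi = ⋆-hurwitz u (conj Q) (conj-hurwitz Q hQ)
    lemma : ∀ u N → + 4 * (u * N - + 1) ≡ u * (N * + 4) - + 4
    lemma = solve-∀
    p∣u·sumSq-4 : + p ∣ₛ u * sumSq Q - + 4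
    p∣u·sumSq-4 = subst (λ s → + p ∣ₛ u * s - + 4) (sym (sumSq≡norm*4 Q hQ))
                        (subst (+ p ∣ₛ_) (lemma u (norm Q)) (∣n⇒∣m*n (+ 4) p∣uN-1))
    u⋆sumSq≈4 : u ⋆ scalar (sumSq Q) ≈ scalar (+ 4)
    u⋆sumSq≈4 = ≈-trans (≈-reflexive (⋆-scalar u (sumSq Q))) (scalar-≈ p∣u·sumSq-4)
    QQi≈4 : Q ·ℤ Qi ≈ (+ 2) ⋆ oneH
    QQi≈4 = ≈-trans (≈-reflexive (trans (·ℤ-⋆ u Q (conj Q)) (cong (u ⋆_) (·ℤ-conjʳ Q)))) u⋆sumSq≈4
    QiQ≈4 : Qi ·ℤ Q ≈ (+ 2) ⋆ oneH
    QiQ≈4 = ≈-trans (≈-reflexive (trans (⋆-·ℤ u (conj Q) Q) (cong (u ⋆_) (·ℤ-conjˡ Q)))) u⋆sumSq≈4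

  conjugate-annihilates : ∀ P Q Q′ P′ H H′ Qi t t′ →
    (+ 2) ⋆ t ≈ H ·ℤ P → P ·ℤ Q ≡ Q′ ·ℤ P′ → (+ 2) ⋆ t′ ≈ H′ ·ℤ P′ → + p ∣ₛ re t′ → + p ∣ₛ sumSq P′ →
    ((Qi ·ℤ t) ·ℤ Q) ·ℤ t′ ≈ zeroH
  conjugate-annihilates P Q Q′ P′ H H′ Qi t t′ 2t≈HP PQ≡Q′P′ 2t′≈H′P′ p∣t′₀ p∣N[P′] =
    ⋆≈zeroH⇒≈zeroH (- + 4) (p∤4 ∘ ∣m⇒∣-m) (begin
      (- + 4) ⋆ (S ·ℤ t′)                        ≡⟨ scalars ⟩
      ((+ 2) ⋆ S) ·ℤ ((- + 2) ⋆ t′)              ≈⟨ ≈-·ℤ (2⋆conjugate≈ P Q Q′ P′ H Qi t 2t≈HP PQ≡Q′P′)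
                                                         (-2⋆≈conj P′ H′ t′ 2t′≈H′P′ p∣t′₀) ⟩
      (A ·ℤ P′) ·ℤ (conj P′ ·ℤ conj H′)          ≡⟨ trans (·ℤ-assoc A P′ _) (cong (A ·ℤ_) (sym (·ℤ-assoc P′ (conj P′) (conj H′)))) ⟩
      A ·ℤ ((P′ ·ℤ conj P′) ·ℤ conj H′)          ≈⟨ ≈-·ℤʳ A (≈-·ℤˡ (conj H′) (·ℤ-conj≈zeroH P′ p∣N[P′])) ⟩
      A ·ℤ (zeroH ·ℤ conj H′)                    ≡⟨ quat-identity (env A (conj H′) zeroH (+ 0) (+ 0)) (𝑿 ·ᵖ (𝟎 ·ᵖ 𝒀)) 𝟎 refl refl refl refl ⟩
      zeroH                                      ∎)
    where
    open ≈-Reasoning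
    S A : Quat
    S = (Qi ·ℤ t) ·ℤ Q
    A = (Qi ·ℤ H) ·ℤ Q′
    scalars : (- + 4) ⋆ (S ·ℤ t′) ≡ ((+ 2) ⋆ S) ·ℤ ((- + 2) ⋆ t′)
    scalars = sym (trans (⋆-·ℤ (+ 2) S ((- + 2) ⋆ t′)) (trans (cong ((+ 2) ⋆_) (·ℤ-⋆ (- + 2) S t′)) (⋆-⋆ (+ 2) (- + 2) (S ·ℤ t′))))

  isTR-conjugate-proportional : ∀ P Q Q′ P′ Qi t t′ →
    Hurwitz P → Hurwitz Q → Hurwitz Q′ → Hurwitz P′ → norm P′ ≡ + p → P ⊗ Q ≡ Q′ ⊗ P′ →
    InvMod p Q Qi → IsTR p P t → IsTR p P′ t′ →
    Σ ℤ λ l → ¬ (+ p ∣ l) × CongMod p t′ (l ⋆ ((Qi ⊗ t) ⊗ Q))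
  isTR-conjugate-proportional P Q Q′ P′ Qi t t′ hP hQ hQ′ hP′ N[P′]≡p P⊗Q≡Q′⊗P′ (hQi , Q⊗Qi≈1 , _)
    (ht , (H , hH , t≈H⊗P) , p∣t₀ , t≉0) (ht′ , (H′ , hH′ , t′≈H′⊗P′) , p∣t′₀ , t′≉0) =
    L * + 4 , ∤a∧∤b⇒∤ab p-prime p∤L p∤4 ∘ ∣ᵤ⇒∣ , ≈⇒CongMod t′ ((L * + 4) ⋆ s) ht′ (⋆-hurwitz (L * + 4) s hs) t′≈4L⋆s
    where
    s S : Quat
    s = (Qi ⊗ t) ⊗ Q
    S = (Qi ·ℤ t) ·ℤ Q
    hs : Hurwitz s
    hs = ⊗-hurwitz (Qi ⊗ t) Q (⊗-hurwitz Qi t hQi ht) hQ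
    4s≡S : (+ 4) ⋆ s ≡ S
    4s≡S = begin
      (+ 4) ⋆ s                     ≡⟨ ⋆-⋆ (+ 2) (+ 2) s ⟨
      (+ 2) ⋆ ((+ 2) ⋆ s)           ≡⟨ cong ((+ 2) ⋆_) (2⋆⊗≡·ℤ (Qi ⊗ t) Q (⊗-hurwitz Qi t hQi ht) hQ) ⟩
      (+ 2) ⋆ ((Qi ⊗ t) ·ℤ Q)       ≡⟨ ⋆-·ℤ (+ 2) (Qi ⊗ t) Q ⟨
      ((+ 2) ⋆ (Qi ⊗ t)) ·ℤ Q       ≡⟨ cong (_·ℤ Q) (2⋆⊗≡·ℤ Qi t hQi ht) ⟩
      S                             ∎
      where open ≡-Reasoning
    QQi≈4 : Q ·ℤ Qi ≈ scalar (+ 4)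
    QQi≈4 = ⊗-CongMod⇒·ℤ≈2⋆ Q Qi oneH hQ hQi Q⊗Qi≈1
    PQ≡Q′P′ : P ·ℤ Q ≡ Q′ ·ℤ P′
    PQ≡Q′P′ = trans (sym (2⋆⊗≡·ℤ P Q hP hQ)) (trans (cong ((+ 2) ⋆_) P⊗Q≡Q′⊗P′) (2⋆⊗≡·ℤ Q′ P′ hQ′ hP′))
    p∣N[P′] : + p ∣ₛ sumSq P′
    p∣N[P′] = subst (+ p ∣ₛ_) (sym (trans (sumSq≡norm*4 P′ hP′) (cong (_* + 4) N[P′]≡p))) (∣m⇒∣m*n (+ 4) ∣-refl)
    S≉0 : ¬ S ≈ zeroH
    S≉0 = conjugate-≉zeroH (+ 4) Q Qi t QQi≈4 p∤4 (t≉0 ∘ ≈⇒CongMod t zeroH ht zeroH-hurwitz)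
    St′≈0 : S ·ℤ t′ ≈ zeroH
    St′≈0 = conjugate-annihilates P Q Q′ P′ H H′ Qi t t′ (CongMod-⊗⇒2⋆≈·ℤ t H P hH hP t≈H⊗P) PQ≡Q′P′
              (CongMod-⊗⇒2⋆≈·ℤ t′ H′ P′ hH′ hP′ t′≈H′⊗P′) (∣ᵤ⇒∣ p∣t′₀) p∣N[P′]
    t′∥S : Σ ℤ λ L → t′ ≈ L ⋆ S
    t′∥S = proportional S t′ S≉0 (re-conjugate-∣ (+ 4) Q Qi t QQi≈4 (∣ᵤ⇒∣ p∣t₀)) (∣ᵤ⇒∣ p∣t′₀) St′≈0
    L : ℤ
    L = proj₁ t′∥S
    t′≈LS : t′ ≈ L ⋆ S
    t′≈LS = proj₂ t′∥S
    t′≈4L⋆s : t′ ≈ (L * + 4) ⋆ s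
    t′≈4L⋆s = ≈-trans t′≈LS (≈-reflexive (trans (cong (L ⋆_) (sym 4s≡S)) (⋆-⋆ L (+ 4) s)))
    p∤L : ¬ + p ∣ₛ L
    p∤L p∣L = t′≉0 (≈⇒CongMod t′ zeroH ht′ zeroH-hurwitz (≈-trans t′≈LS (∣⇒⋆≈zeroH p∣L)))

theorem3p1 : (p q : ℕ) → Prime p → Prime q → p ≢ q → ¬ (+ 2 ∣ + p) →
    (P Q Q′ P′ : Quat) →
    HurwitzPrime P → norm P ≡ + p →
    HurwitzPrime Q → norm Q ≡ + q →
    HurwitzPrime Q′ → norm Q′ ≡ + q →
    HurwitzPrime P′ → norm P′ ≡ + p →
    P ⊗ Q ≡ Q′ ⊗ P′ →
    (Σ Quat λ Qi → InvMod p Q Qi) ×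
    ((Qi t t′ : Quat) → InvMod p Q Qi → IsTR p P t → IsTR p P′ t′ →
      Σ ℤ λ l → ¬ (+ p ∣ l) × CongMod p t′ (l ⋆ ((Qi ⊗ t) ⊗ Q)))
theorem3p1 p q p-prime q-prime p≢q p-odd P Q Q′ P′ P-prime _ Q-prime N[Q]≡q Q′-prime _ P′-prime N[P′]≡p P⊗Q≡Q′⊗P′ =
  invertible-mod Q (proj₁ Q-prime) p∤N[Q] ,
  λ Qi t t′ → isTR-conjugate-proportional P Q Q′ P′ Qi t t′
                (proj₁ P-prime) (proj₁ Q-prime) (proj₁ Q′-prime) (proj₁ P′-prime) N[P′]≡p P⊗Q≡Q′⊗P′
  where
  open OddPrime p p-prime p-odd
  p∤N[Q] : ¬ + p ∣ₛ norm Q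
  p∤N[Q] p∣N = p≢q (prime∣prime⇒≡ p-prime q-prime (∣⇒∣ᵤ (subst (+ p ∣ₛ_) N[Q]≡q p∣N)))
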